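{- Run Algorithm DECOMP on a binary tree $T^b$ with $n$ vertices. With high probability, the while loop of Algorithm DECOMP has at most $O(\log n)$ iterations.
   Context: Algorithm DECOMP (input: binary tree $T^b$ with $n$ vertices, parameter $m$). A component is a set of vertices of $T^b$; contracting all components gives the component tree. Initially $C$ is the set of singleton components, $F=\emptyset$. While $|C|>14m$, do one iteration: set $S=\emptyset$; for each $c\in C\setminus F$: if $c$ is the root component, add it to $S$; else if $c$ has exactly two children components, add it to $S$; else if the parent component of $c$ is in $F$, add it to $S$; else if $c$ has exactly one child component, add it to $S$ independently with probability $1/2$. Then each $c\in C\setminus(F\cup S)$ is merged into its closest ancestor (in the component tree) that is in $S$. Finally every component in $C\setminus F$ with at least $n/m$ vertices of $T^b$ is added to $F$. "With high probability" means with probability at least $1-1/\mathrm{poly}(n)$. -}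

module Defs where

open import Data.Nat using (ℕ; zero; suc; _+_; _*_; _≤_; _<_; _≡ᵇ_; _<ᵇ_; _≤ᵇ_)
open import Data.Bool using (Bool; true; false; not; _∧_; _∨_; if_then_else_)
open import Data.Fin using (Fin; toℕ)
open import Data.List using (List; []; _∷_; [_]; length; filterᵇ; map; concatMap; allFin)
open import Data.Vec using (Vec; lookup) renaming ([] to []ᵛ; _∷_ to _∷ᵛ_)

-- Convention: vertices are labelled so that the root is vertex 0 and every
-- non-root vertex has a parent with a strictly smaller label (any rooted
-- tree admits such a labelling, e.g. BFS order).  The value of 'parent' at
-- the root is irrelevant.

isRoot : ∀ {n} → Fin n → Bool
isRoot v = toℕ v ≡ᵇ 0

_==_ : ∀ {n} → Fin n → Fin n → Bool
a == b = toℕ a ≡ᵇ toℕ b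

childrenOf : ∀ {n} → (Fin n → Fin n) → Fin n → List (Fin n)
childrenOf {n} parent v = filterᵇ (λ u → not (isRoot u) ∧ (parent u == v)) (allFin n)

record BinaryTree (n : ℕ) : Set where
  field
    parent   : Fin n → Fin n
    parent-< : ∀ v → 0 < toℕ v → toℕ (parent v) < toℕ v
    binary   : ∀ v → length (childrenOf parent v) ≤ 2

-- Every component is a connected set of vertices (merging a component into
-- its closest S-ancestor keeps connectivity), so it is identified by its
-- topmost vertex, its "head".  'head v' is the head of the component of v;
-- the components C are the vertices h with head h = h.  'inF h' says that
-- the component with head h belongs to F.

record State (n : ℕ) : Set where
  constructor st
  field
    head : Fin n → Fin n
    inF  : Fin n → Bool

module DECOMP {n : ℕ} (Tb : BinaryTree n) (m : ℕ) where
  open BinaryTree Tb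
  open State

  initial : State n
  initial = st (λ v → v) (λ _ → false)

  heads : State n → List (Fin n)
  heads s = filterᵇ (λ h → head s h == h) (allFin n)

  numComps : State n → ℕ
  numComps s = length (heads s)

  parentComp : State n → Fin n → Fin n
  parentComp s c = head s (parent c)

  childComps : State n → Fin n → List (Fin n)
  childComps s c = filterᵇ (λ h → not (isRoot h) ∧ (parentComp s h == c)) (heads s)

  childCount : State n → Fin n → ℕ
  childCount s c = length (childComps s c)

  -- membership of component c in S; 'coins' gives one fair coin per
  -- component (indexed by its head) for the current iteration
  inS : State n → Vec Bool n → Fin n → Bool
  inS s coins c =
    if inF s c then false
    else if isRoot c then true
    else if childCount s c ≡ᵇ 2 then true
    else if inF s (parentComp s c) then true
    else if childCount s c ≡ᵇ 1 then lookup coins c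
    else false

  -- closest ancestor component in S (components in S or F stay put).
  -- The fuel n suffices since the tree has depth < n.
  climb : State n → Vec Bool n → ℕ → Fin n → Fin n
  climb s coins zero    h = h
  climb s coins (suc k) h =
    if inS s coins h ∨ inF s h then h
    else climb s coins k (parentComp s h)

  compSize : (Fin n → Fin n) → Fin n → ℕ
  compSize hd h = length (filterᵇ (λ v → hd v == h) (allFin n))

  step : State n → Vec Bool n → State n
  step s coins = st newHead newF
    where
    newHead : Fin n → Fin n
    newHead v = climb s coins n (head s v)
    newF : Fin n → Bool
    newF h = inF s h ∨ ((newHead h == h) ∧ (n ≤ᵇ compSize newHead h * m))

  loopCond : State n → Bool
  loopCond s = (14 * m) <ᵇ numComps s

  guardedStep : State n → Vec Bool n → State n
  guardedStep s coins = if loopCond s then step s coins else s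

  runFrom : ∀ {L} → State n → Vec (Vec Bool n) L → State n
  runFrom s []ᵛ         = s
  runFrom s (c ∷ᵛ cs)   = runFrom (guardedStep s c) cs

  -- the while loop performs more than L iterations (given the coins of the
  -- first L iterations) iff the loop condition still holds after L rounds
  moreThan : ∀ L → Vec (Vec Bool n) L → Bool
  moreThan L coins = loopCond (runFrom initial coins)

-- Uniform finite probability space of coin flips.

vecsOf : ∀ {A : Set} → List A → (k : ℕ) → List (Vec A k)
vecsOf xs zero    = [ []ᵛ ]
vecsOf xs (suc k) = concatMap (λ x → map (x ∷ᵛ_) (vecsOf xs k)) xs

coinOutcomes : (n L : ℕ) → List (Vec (Vec Bool n) L)
coinOutcomes n L = vecsOf (vecsOf (true ∷ false ∷ []) n) L

badCount : ∀ {n} → BinaryTree n → (m L : ℕ) → ℕ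
badCount {n} Tb m L = length (filterᵇ (DECOMP.moreThan Tb m L) (coinOutcomes n L))

-- A component survives an iteration (stays a component, i.e. lies in S ∪ F) only if it is forced
-- (in F, the root, with two child components, or with its parent component in F) or it has one
-- child component and wins its coin toss. The components in F are disjoint with at least n/m
-- vertices each, so |F| ≤ m, and as the component tree stays binary at most 2m components hang
-- below F, while twice the number of two-child components plus the number of one-child components
-- is at most |C|. Hence an iteration leaves at most 3m + 1 + |C|/2 ≤ (11/14)|C| components in
-- expectation while |C| > 14m. The potential |C|·[|C| > 14m] thus has expectation at most
-- (11/14)^L · n after L iterations and dominates the indicator of the loop still running, so by
-- Markov's inequality the loop survives L = 6(d+1)⌊log₂ n⌋ iterations with probability at most
-- n (11/14)^L ≤ n^(-d), because n ≤ 4^⌊log₂ n⌋ and 4·11^6 ≤ 14^6.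

module Submission where

open import Defs
open import Data.Nat using (ℕ; zero; suc; _+_; _*_; _^_; _≤_; _<_; _≡ᵇ_; z≤n; s≤s; NonZero; >-nonZero; ⌊_/2⌋)
open import Data.Nat.Properties
open import Data.Nat.Induction using (<-rec)
open import Data.Nat.Logarithm
open import Data.Nat.Tactic.RingSolver using (solve-∀)
open import Data.Bool using (Bool; true; false; not; _∧_; _∨_; if_then_else_)
open import Data.Bool.Properties using (T-≡; ∧-assoc; ∨-zeroʳ; ∧-identityʳ; ∧-zeroʳ)
open import Data.Fin using (Fin; toℕ) renaming (zero to fzero; suc to fsuc)
open import Data.Fin.Properties using (toℕ<n; toℕ-injective)
open import Data.List using (List; []; _∷_; length; filterᵇ; map; concatMap; tabulate; allFin; _++_)
open import Data.Vec using (Vec; lookup) renaming (_∷_ to _∷ᵛ_)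
open import Data.Product using (_×_; _,_; proj₁; proj₂; ∃-syntax)
open import Function using (_∘_; const; Equivalence)
open import Relation.Binary.PropositionalEquality
open import Algebra.Properties.CommutativeSemigroup *-commutativeSemigroup using (x∙yz≈y∙xz)
open import Algebra.Properties.Semiring.Sum +-*-semiring
  using (sum; sum-syntax; sum-cong-≗; ∑-distrib-+; ∑-comm; *-distribˡ-sum; sum-replicate-zero)

-- Finite sums and counting

⟦_⟧ : Bool → ℕ
⟦ true ⟧  = 1
⟦ false ⟧ = 0

⟦⟧≤1 : ∀ b → ⟦ b ⟧ ≤ 1
⟦⟧≤1 true  = s≤s z≤n
⟦⟧≤1 false = z≤n

⟦∧⟧ : ∀ a b → ⟦ a ∧ b ⟧ ≡ ⟦ a ⟧ * ⟦ b ⟧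
⟦∧⟧ true  true  = refl
⟦∧⟧ true  false = refl
⟦∧⟧ false b     = refl

⟦⟧-mono : ∀ {a b} → (a ≡ true → b ≡ true) → ⟦ a ⟧ ≤ ⟦ b ⟧
⟦⟧-mono {true}  a⇒b rewrite a⇒b refl = ≤-refl
⟦⟧-mono {false} a⇒b = z≤n

∑-mono-≤ : ∀ {n} {f g : Fin n → ℕ} → (∀ i → f i ≤ g i) → sum f ≤ sum g
∑-mono-≤ {zero}  f≤g = z≤n
∑-mono-≤ {suc n} f≤g = +-mono-≤ (f≤g fzero) (∑-mono-≤ (f≤g ∘ fsuc))

∑-point : ∀ {n} (a : Fin n) (g : Fin n → ℕ) → ∑[ c < n ] (⟦ a == c ⟧ * g c) ≡ g a
∑-point {suc n} fzero g = begin
  g fzero + 0 + ∑[ c < n ] 0 ≡⟨ cong₂ _+_ (+-identityʳ (g fzero)) (sum-replicate-zero n) ⟩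
  g fzero + 0                  ≡⟨ +-identityʳ (g fzero) ⟩
  g fzero                      ∎
  where open ≡-Reasoning
∑-point {suc n} (fsuc a) g = ∑-point a (g ∘ fsuc)

count : ∀ {n} → (Fin n → Bool) → ℕ
count {n} P = ∑[ i < n ] ⟦ P i ⟧

count-cong : ∀ {n} {P Q : Fin n → Bool} → (∀ i → P i ≡ Q i) → count P ≡ count Q
count-cong P≗Q = sum-cong-≗ (cong ⟦_⟧ ∘ P≗Q)

count-mono : ∀ {n} {P Q : Fin n → Bool} → (∀ i → P i ≡ true → Q i ≡ true) → count P ≤ count Q
count-mono P⇒Q = ∑-mono-≤ (λ i → ⟦⟧-mono (P⇒Q i))

count≤n : ∀ {n} (P : Fin n → Bool) → count P ≤ n
count≤n {zero}  P = z≤n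
count≤n {suc n} P = +-mono-≤ (⟦⟧≤1 (P fzero)) (count≤n (P ∘ fsuc))

count-true : ∀ n → count {n} (const true) ≡ n
count-true zero    = refl
count-true (suc n) = cong suc (count-true n)

count-split : ∀ {n} (P Q : Fin n → Bool) → count P ≡ count (λ i → P i ∧ Q i) + count (λ i → P i ∧ not (Q i))
count-split {n} P Q = trans (sum-cong-≗ (λ i → split (P i) (Q i))) (∑-distrib-+ {n} _ _)
  where
  split : ∀ p q → ⟦ p ⟧ ≡ ⟦ p ∧ q ⟧ + ⟦ p ∧ not q ⟧
  split true  true  = refl
  split true  false = refl
  split false q     = refl

∑-fibres : ∀ {n k} (Q : Fin k → Bool) (P : Fin n → Bool) (f : Fin n → Fin k) →
           ∑[ c < k ] (⟦ Q c ⟧ * count (λ h → P h ∧ (f h == c))) ≡ count (λ h → P h ∧ Q (f h))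
∑-fibres {n} {k} Q P f = begin
  ∑[ c < k ] (⟦ Q c ⟧ * ∑[ h < n ] ⟦ P h ∧ (f h == c) ⟧)   ≡⟨ sum-cong-≗ (λ c → *-distribˡ-sum {n} ⟦ Q c ⟧ _) ⟩
  ∑[ c < k ] ∑[ h < n ] (⟦ Q c ⟧ * ⟦ P h ∧ (f h == c) ⟧)   ≡⟨ ∑-comm {k} {n} _ ⟩
  ∑[ h < n ] ∑[ c < k ] (⟦ Q c ⟧ * ⟦ P h ∧ (f h == c) ⟧)
    ≡⟨ sum-cong-≗ (λ h → sum-cong-≗ (λ c → regroup (Q c) (P h) (f h == c))) ⟩
  ∑[ h < n ] ∑[ c < k ] (⟦ f h == c ⟧ * (⟦ P h ⟧ * ⟦ Q c ⟧))
    ≡⟨ sum-cong-≗ (λ h → ∑-point (f h) (λ c → ⟦ P h ⟧ * ⟦ Q c ⟧)) ⟩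
  ∑[ h < n ] (⟦ P h ⟧ * ⟦ Q (f h) ⟧)                        ≡⟨ sum-cong-≗ (λ h → sym (⟦∧⟧ (P h) (Q (f h)))) ⟩
  count (λ h → P h ∧ Q (f h))                               ∎
  where
  open ≡-Reasoning
  regroup : ∀ q p e → ⟦ q ⟧ * ⟦ p ∧ e ⟧ ≡ ⟦ e ⟧ * (⟦ p ⟧ * ⟦ q ⟧)
  regroup true  true  true  = refl
  regroup true  true  false = refl
  regroup true  false e     = sym (*-zeroʳ ⟦ e ⟧)
  regroup false true  true  = refl
  regroup false true  false = refl
  regroup false false e     = sym (*-zeroʳ ⟦ e ⟧)

sumOver : {A : Set} → List A → (A → ℕ) → ℕ
sumOver []       f = 0
sumOver (x ∷ xs) f = f x + sumOver xs f

infix 10 sumOver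
syntax sumOver xs (λ x → e) = ∑[ x ∈ xs ] e

module _ {A : Set} where

  sumOver-cong : ∀ (xs : List A) {f g : A → ℕ} → (∀ x → f x ≡ g x) → sumOver xs f ≡ sumOver xs g
  sumOver-cong []       f≗g = refl
  sumOver-cong (x ∷ xs) f≗g = cong₂ _+_ (f≗g x) (sumOver-cong xs f≗g)

  sumOver-mono-≤ : ∀ (xs : List A) {f g : A → ℕ} → (∀ x → f x ≤ g x) → sumOver xs f ≤ sumOver xs g
  sumOver-mono-≤ []       f≤g = z≤n
  sumOver-mono-≤ (x ∷ xs) f≤g = +-mono-≤ (f≤g x) (sumOver-mono-≤ xs f≤g)

  sumOver-zero : ∀ (xs : List A) → sumOver xs (const 0) ≡ 0
  sumOver-zero []       = refl
  sumOver-zero (x ∷ xs) = sumOver-zero xs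

  *-distribˡ-sumOver : ∀ k (xs : List A) (f : A → ℕ) → k * sumOver xs f ≡ sumOver xs (λ x → k * f x)
  *-distribˡ-sumOver k []       f = *-zeroʳ k
  *-distribˡ-sumOver k (x ∷ xs) f =
    trans (*-distribˡ-+ k (f x) (sumOver xs f)) (cong (k * f x +_) (*-distribˡ-sumOver k xs f))

  sumOver-∑-comm : ∀ {n} (xs : List A) (f : A → Fin n → ℕ) →
                   sumOver xs (λ x → ∑[ i < n ] f x i) ≡ ∑[ i < n ] sumOver xs (λ x → f x i)
  sumOver-∑-comm {n} []       f = sym (sum-replicate-zero n)
  sumOver-∑-comm {n} (x ∷ xs) f =
    trans (cong (sum (f x) +_) (sumOver-∑-comm xs f)) (sym (∑-distrib-+ {n} (f x) _))

  sumOver-++ : ∀ (xs ys : List A) f → sumOver (xs ++ ys) f ≡ sumOver xs f + sumOver ys f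
  sumOver-++ []       ys f = refl
  sumOver-++ (x ∷ xs) ys f = trans (cong (f x +_) (sumOver-++ xs ys f)) (sym (+-assoc (f x) _ _))

  sumOver-filter : ∀ (p : A → Bool) xs f → sumOver (filterᵇ p xs) f ≡ sumOver xs (λ x → ⟦ p x ⟧ * f x)
  sumOver-filter p []       f = refl
  sumOver-filter p (x ∷ xs) f with p x
  ... | true  = cong₂ _+_ (sym (+-identityʳ (f x))) (sumOver-filter p xs f)
  ... | false = sumOver-filter p xs f

  length≡sumOver : ∀ (xs : List A) → length xs ≡ sumOver xs (const 1)
  length≡sumOver []       = refl
  length≡sumOver (x ∷ xs) = cong suc (length≡sumOver xs)

  length-filter : ∀ (p : A → Bool) xs → length (filterᵇ p xs) ≡ sumOver xs (⟦_⟧ ∘ p)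
  length-filter p xs = begin
    length (filterᵇ p xs)              ≡⟨ length≡sumOver (filterᵇ p xs) ⟩
    sumOver (filterᵇ p xs) (const 1)   ≡⟨ sumOver-filter p xs (const 1) ⟩
    sumOver xs (λ x → ⟦ p x ⟧ * 1)     ≡⟨ sumOver-cong xs (λ x → *-identityʳ ⟦ p x ⟧) ⟩
    sumOver xs (⟦_⟧ ∘ p)               ∎
    where open ≡-Reasoning

  sumOver-tabulate : ∀ {n} (g : Fin n → A) f → sumOver (tabulate g) f ≡ ∑[ i < n ] f (g i)
  sumOver-tabulate {zero}  g f = refl
  sumOver-tabulate {suc n} g f = cong (f (g fzero) +_) (sumOver-tabulate (g ∘ fsuc) f)

sumOver-map : ∀ {A B : Set} (g : A → B) (xs : List A) f → sumOver (map g xs) f ≡ sumOver xs (f ∘ g)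
sumOver-map g []       f = refl
sumOver-map g (x ∷ xs) f = cong (f (g x) +_) (sumOver-map g xs f)

sumOver-concatMap : ∀ {A B : Set} (g : A → List B) (xs : List A) f →
                    sumOver (concatMap g xs) f ≡ sumOver xs (λ x → sumOver (g x) f)
sumOver-concatMap g []       f = refl
sumOver-concatMap g (x ∷ xs) f =
  trans (sumOver-++ (g x) (concatMap g xs) f) (cong (sumOver (g x) f +_) (sumOver-concatMap g xs f))

length-filter-allFin : ∀ {n} (p : Fin n → Bool) → length (filterᵇ p (allFin n)) ≡ count p
length-filter-allFin {n} p = trans (length-filter p (allFin n)) (sumOver-tabulate (λ i → i) (⟦_⟧ ∘ p))

length-filter-filter-allFin : ∀ {n} (p q : Fin n → Bool) →
                              length (filterᵇ q (filterᵇ p (allFin n))) ≡ count (λ i → p i ∧ q i)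
length-filter-filter-allFin {n} p q = begin
  length (filterᵇ q (filterᵇ p (allFin n)))                 ≡⟨ length-filter q (filterᵇ p (allFin n)) ⟩
  sumOver (filterᵇ p (allFin n)) (⟦_⟧ ∘ q)                  ≡⟨ sumOver-filter p (allFin n) (⟦_⟧ ∘ q) ⟩
  sumOver (allFin n) (λ i → ⟦ p i ⟧ * ⟦ q i ⟧)
    ≡⟨ sumOver-tabulate (λ i → i) (λ i → ⟦ p i ⟧ * ⟦ q i ⟧) ⟩
  ∑[ i < n ] (⟦ p i ⟧ * ⟦ q i ⟧)                            ≡⟨ sum-cong-≗ (λ i → sym (⟦∧⟧ (p i) (q i))) ⟩
  count (λ i → p i ∧ q i)                                   ∎
  where open ≡-Reasoning

module _ {A : Set} (xs : List A) where

  sumOver-vecsOf-suc : ∀ L (f : Vec A (suc L) → ℕ) →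
    sumOver (vecsOf xs (suc L)) f ≡ sumOver xs (λ x → sumOver (vecsOf xs L) (λ v → f (x ∷ᵛ v)))
  sumOver-vecsOf-suc L f = trans (sumOver-concatMap (λ x → map (x ∷ᵛ_) (vecsOf xs L)) xs f)
                                 (sumOver-cong xs (λ x → sumOver-map (x ∷ᵛ_) (vecsOf xs L) f))

  length-vecsOf : ∀ L → length (vecsOf xs L) ≡ length xs ^ L
  length-vecsOf zero    = refl
  length-vecsOf (suc L) = begin
    length (vecsOf xs (suc L))                       ≡⟨ length≡sumOver (vecsOf xs (suc L)) ⟩
    sumOver (vecsOf xs (suc L)) (const 1)            ≡⟨ sumOver-vecsOf-suc L (const 1) ⟩
    sumOver xs (λ _ → sumOver (vecsOf xs L) (const 1))
      ≡⟨ sumOver-cong xs (λ _ → sym (length≡sumOver (vecsOf xs L))) ⟩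
    sumOver xs (λ _ → length (vecsOf xs L))
      ≡⟨ sumOver-cong xs (λ _ → trans (length-vecsOf L) (sym (*-identityʳ _))) ⟩
    sumOver xs (λ _ → length xs ^ L * 1)             ≡⟨ *-distribˡ-sumOver (length xs ^ L) xs (const 1) ⟨
    length xs ^ L * sumOver xs (const 1)             ≡⟨ cong (length xs ^ L *_) (length≡sumOver xs) ⟨
    length xs ^ L * length xs                        ≡⟨ *-comm (length xs ^ L) (length xs) ⟩
    length xs ^ suc L                                ∎
    where open ≡-Reasoning

coinFlips : ∀ n → List (Vec Bool n)
coinFlips n = vecsOf (true ∷ false ∷ []) n

length-coinFlips : ∀ n → length (coinFlips n) ≡ 2 ^ n
length-coinFlips n = length-vecsOf (true ∷ false ∷ []) n

fair-coin : ∀ n (i : Fin n) → 2 * (∑[ cs ∈ coinFlips n ] ⟦ lookup cs i ⟧) ≡ 2 ^ n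
fair-coin (suc n) fzero = begin
  2 * (∑[ cs ∈ coinFlips (suc n) ] ⟦ lookup cs fzero ⟧)
    ≡⟨ cong (2 *_) (sumOver-vecsOf-suc (true ∷ false ∷ []) n _) ⟩
  2 * (sumOver (coinFlips n) (const 1) + (sumOver (coinFlips n) (const 0) + 0))
      ≡⟨ cong (λ z → 2 * (sumOver (coinFlips n) (const 1) + (z + 0))) (sumOver-zero (coinFlips n)) ⟩
  2 * (sumOver (coinFlips n) (const 1) + 0)
    ≡⟨ cong (λ z → 2 * (z + 0)) (trans (sym (length≡sumOver (coinFlips n))) (length-coinFlips n)) ⟩
  2 * (2 ^ n + 0)                                                 ≡⟨ cong (2 *_) (+-identityʳ (2 ^ n)) ⟩
  2 ^ suc n                                                       ∎
  where open ≡-Reasoning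
fair-coin (suc n) (fsuc i) = begin
  2 * (∑[ cs ∈ coinFlips (suc n) ] ⟦ lookup cs (fsuc i) ⟧)
    ≡⟨ cong (2 *_) (sumOver-vecsOf-suc (true ∷ false ∷ []) n _) ⟩
  2 * (X + (X + 0))                                       ≡⟨ cong (λ z → 2 * (X + z)) (+-identityʳ X) ⟩
  2 * (X + X)                                             ≡⟨ *-distribˡ-+ 2 X X ⟩
  2 * X + 2 * X                                           ≡⟨ cong₂ _+_ (fair-coin n i) (fair-coin n i) ⟩
  2 ^ n + 2 ^ n                                           ≡⟨ cong (2 ^ n +_) (+-identityʳ (2 ^ n)) ⟨
  2 ^ suc n                                               ∎
  where
  open ≡-Reasoning
  X = ∑[ cs ∈ coinFlips n ] ⟦ lookup cs i ⟧

-- Invariants preserved by an iteration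

≡⇒== : ∀ {n} {a b : Fin n} → a ≡ b → (a == b) ≡ true
≡⇒== {a = a} refl = Equivalence.to T-≡ (≡⇒≡ᵇ (toℕ a) (toℕ a) refl)

==⇒≡ : ∀ {n} {a b : Fin n} → (a == b) ≡ true → a ≡ b
==⇒≡ {a = a} {b} a==b = toℕ-injective (≡ᵇ⇒≡ (toℕ a) (toℕ b) (Equivalence.from T-≡ a==b))

∧-true : ∀ {a b} → a ∧ b ≡ true → (a ≡ true) × (b ≡ true)
∧-true {true} {true} _ = refl , refl

∧-intro : ∀ {a b} → a ≡ true → b ≡ true → a ∧ b ≡ true
∧-intro refl refl = refl

≤2∧≢2⇒≤1 : ∀ {x} → x ≤ 2 → (x ≡ᵇ 2) ≡ false → x ≤ 1
≤2∧≢2⇒≤1 {zero}          _ _  = z≤n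
≤2∧≢2⇒≤1 {suc zero}      _ _  = s≤s z≤n
≤2∧≢2⇒≤1 {suc (suc zero)} _ ()
≤2∧≢2⇒≤1 {suc (suc (suc _))} (s≤s (s≤s ())) _

≡true-ext : ∀ {a b} → (a ≡ true → b ≡ true) → (b ≡ true → a ≡ true) → a ≡ b
≡true-ext {true}  a⇒b b⇒a = sym (a⇒b refl)
≡true-ext {false} {true}  a⇒b b⇒a = b⇒a refl
≡true-ext {false} {false} a⇒b b⇒a = refl

-- `inS s coins h ∨ inF s h` as a function of the six Booleans it inspects: membership in F, being
-- the root, having two child components, parent component in F, having one child component, the coin.
keptBy : (inF root two parentInF one coin : Bool) → Bool
keptBy inF root two parentInF one coin =
  (if inF then false else if root then true else if two then true
   else if parentInF then true else if one then coin else false) ∨ inF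

record Dropped (root two parentInF : Bool) : Set where
  field
    non-root   : root ≡ false
    ¬two       : two ≡ false
    parent-∉F  : parentInF ≡ false

keptBy≡false : ∀ inF root two parentInF one coin → keptBy inF root two parentInF one coin ≡ false →
               Dropped root two parentInF
keptBy≡false false false false false one coin _ = record { non-root = refl ; ¬two = refl ; parent-∉F = refl }
keptBy≡false true  root  two   parentInF one coin ()
keptBy≡false false true  two   parentInF one coin ()
keptBy≡false false false true  parentInF one coin ()
keptBy≡false false false false true      one coin ()

isRoot≡false⇒0< : ∀ {n} (c : Fin n) → isRoot c ≡ false → 0 < toℕ c
isRoot≡false⇒0< c r with toℕ c | r
... | suc _ | _ = s≤s z≤n

keptBy≡true : ∀ inF root two parentInF one coin → keptBy inF root two parentInF one coin ≡ true →
              ((inF ∨ (root ∨ (two ∨ (not root ∧ parentInF)))) ∨ (one ∧ coin)) ≡ true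
keptBy≡true true  root  two   parentInF one   coin  _ = refl
keptBy≡true false true  two   parentInF one   coin  _ = refl
keptBy≡true false false true  parentInF one   coin  _ = refl
keptBy≡true false false false true      one   coin  _ = refl
keptBy≡true false false false false     true  true  _ = refl
keptBy≡true false false false false     true  false ()
keptBy≡true false false false false     false coin  ()

module Invariant {n : ℕ} (Tb : BinaryTree n) (m : ℕ) where
  open BinaryTree Tb
  open DECOMP Tb m
  open State

  isHead : State n → Fin n → Bool
  isHead s h = head s h == h

  numComps≡count : ∀ s → numComps s ≡ count (isHead s)
  numComps≡count s = length-filter-allFin (isHead s)

  childCount≡count : ∀ s c → childCount s c ≡ count (λ h → isHead s h ∧ (not (isRoot h) ∧ (parentComp s h == c)))
  childCount≡count s c = length-filter-filter-allFin (isHead s) _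

  compSize≡count : ∀ hd h → compSize hd h ≡ count (λ v → hd v == h)
  compSize≡count hd h = length-filter-allFin (λ v → hd v == h)

  ∑-compSize : ∀ (hd : Fin n → Fin n) → ∑[ h < n ] compSize hd h ≡ n
  ∑-compSize hd = begin
    ∑[ h < n ] compSize hd h
      ≡⟨ sum-cong-≗ (λ c → trans (compSize≡count hd c) (sym (+-identityʳ _))) ⟩
    ∑[ c < n ] (⟦ true ⟧ * count (λ v → true ∧ (hd v == c)))
      ≡⟨ ∑-fibres (const true) (const true) hd ⟩
    count {n} (const true)                                           ≡⟨ count-true n ⟩
    n                                                                ∎
    where open ≡-Reasoning

  ∑-weighted-childCount : ∀ s (Q : Fin n → Bool) →
    ∑[ c < n ] (⟦ Q c ⟧ * childCount s c) ≡ count (λ h → (isHead s h ∧ not (isRoot h)) ∧ Q (parentComp s h))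
  ∑-weighted-childCount s Q =
    trans (sum-cong-≗ (λ c → cong (⟦ Q c ⟧ *_) (trans (childCount≡count s c)
            (count-cong {n} (λ h → sym (∧-assoc (isHead s h) (not (isRoot h)) (parentComp s h == c)))))))
          (∑-fibres Q (λ h → isHead s h ∧ not (isRoot h)) (parentComp s))

  record WellFormed (s : State n) : Set where
    field
      head-idem    : ∀ v → head s (head s v) ≡ head s v
      head-≤       : ∀ v → toℕ (head s v) ≤ toℕ v
      comps-binary : ∀ c → head s c ≡ c → childCount s c ≤ 2
      F⇒head       : ∀ h → inF s h ≡ true → head s h ≡ h
      F-large      : ∀ h → inF s h ≡ true → n ≤ compSize (head s) h * m

  wellFormed-initial : WellFormed initial
  wellFormed-initial = record
    { head-idem    = λ _ → refl
    ; head-≤       = λ _ → ≤-refl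
    ; comps-binary = λ c _ → ≤-trans (≤-reflexive (initial-childCount c)) (binary c)
    ; F⇒head       = λ _ ()
    ; F-large      = λ _ ()
    }
    where
    initial-childCount : ∀ c → childCount initial c ≡ length (childrenOf parent c)
    initial-childCount c = begin
      childCount initial c                                      ≡⟨ childCount≡count initial c ⟩
      count (λ h → (h == h) ∧ (not (isRoot h) ∧ (parent h == c)))
        ≡⟨ count-cong {n} (λ h → cong (_∧ (not (isRoot h) ∧ (parent h == c))) (≡⇒== {a = h} refl)) ⟩
      count (λ h → not (isRoot h) ∧ (parent h == c))
        ≡⟨ length-filter-allFin (λ h → not (isRoot h) ∧ (parent h == c)) ⟨
      length (childrenOf parent c)                               ∎
      where open ≡-Reasoning

  module Step (s : State n) (wf : WellFormed s) (coins : Vec Bool n) where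
    open WellFormed wf

    kept : Fin n → Bool
    kept h = inS s coins h ∨ inF s h

    dropped : ∀ c → kept c ≡ false → Dropped (isRoot c) (childCount s c ≡ᵇ 2) (inF s (parentComp s c))
    dropped c = keptBy≡false (inF s c) (isRoot c) (childCount s c ≡ᵇ 2) (inF s (parentComp s c))
                             (childCount s c ≡ᵇ 1) (lookup coins c)

    dropped-parentComp-< : ∀ c → kept c ≡ false → toℕ (parentComp s c) < toℕ c
    dropped-parentComp-< c e =
      ≤-<-trans (head-≤ (parent c)) (parent-< c (isRoot≡false⇒0< c (Dropped.non-root (dropped c e))))

    F⇒kept : ∀ h → inF s h ≡ true → kept h ≡ true
    F⇒kept h e = trans (cong (inS s coins h ∨_) e) (∨-zeroʳ (inS s coins h))

    climb-kept : ∀ k c → toℕ c < k → kept c ≡ true → climb s coins k c ≡ c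
    climb-kept (suc k) c _ e rewrite e = refl

    climb-fuel : ∀ k k′ c → toℕ c < k → toℕ c < k′ → climb s coins k c ≡ climb s coins k′ c
    climb-fuel (suc k) (suc k′) c c<k c<k′ with kept c in e
    ... | true  = refl
    ... | false = climb-fuel k k′ (parentComp s c) (≤-trans p<c (≤-pred c<k)) (≤-trans p<c (≤-pred c<k′))
      where p<c = dropped-parentComp-< c e

    climb-dropped : ∀ k c → toℕ c < k → kept c ≡ false → climb s coins k c ≡ climb s coins k (parentComp s c)
    climb-dropped (suc k) c c<k e rewrite e = climb-fuel k (suc k) (parentComp s c) p<k (m<n⇒m<1+n p<k)
      where p<k = ≤-trans (dropped-parentComp-< c e) (≤-pred c<k)

    climb-isKept : ∀ k c → toℕ c < k → kept (climb s coins k c) ≡ true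
    climb-isKept (suc k) c c<k with kept c in e
    ... | true  = e
    ... | false = climb-isKept k (parentComp s c) (≤-trans (dropped-parentComp-< c e) (≤-pred c<k))

    climb-isHead : ∀ k c → head s c ≡ c → head s (climb s coins k c) ≡ climb s coins k c
    climb-isHead zero    c hc = hc
    climb-isHead (suc k) c hc with kept c
    ... | true  = hc
    ... | false = climb-isHead k (parentComp s c) (head-idem (parent c))

    climb-≤ : ∀ k c → toℕ (climb s coins k c) ≤ toℕ c
    climb-≤ zero    c = ≤-refl
    climb-≤ (suc k) c with kept c in e
    ... | true  = ≤-refl
    ... | false = ≤-trans (climb-≤ k (parentComp s c)) (<⇒≤ (dropped-parentComp-< c e))

    -- The climb never steps into F: the parent component of a dropped component is not in F.
    climb-into-F : ∀ k c h → head s c ≡ c → inF s h ≡ true → climb s coins k c ≡ h → c ≡ h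
    climb-into-F zero    c h _  _  c≡h = c≡h
    climb-into-F (suc k) c h hc hF up≡h with kept c in e
    ... | true  = up≡h
    ... | false with () ← trans (sym (Dropped.parent-∉F (dropped c e)))
                               (trans (cong (inF s) (climb-into-F k (parentComp s c) h (head-idem (parent c)) hF up≡h)) hF)

    up : Fin n → Fin n
    up = climb s coins n

    up-kept : ∀ c → kept c ≡ true → up c ≡ c
    up-kept c = climb-kept n c (toℕ<n c)

    up-dropped : ∀ c → kept c ≡ false → up c ≡ up (parentComp s c)
    up-dropped c = climb-dropped n c (toℕ<n c)

    isHead-step : ∀ h → isHead (step s coins) h ≡ (isHead s h ∧ kept h)
    isHead-step h = ≡true-ext to from
      where
      to : isHead (step s coins) h ≡ true → (isHead s h ∧ kept h) ≡ true
      to e = ∧-intro (≡⇒== (trans (cong (head s) (sym h′≡h)) (trans (climb-isHead n (head s h) (head-idem h)) h′≡h)))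
                     (trans (cong kept (sym h′≡h)) (climb-isKept n (head s h) (toℕ<n _)))
        where h′≡h = ==⇒≡ e
      from : (isHead s h ∧ kept h) ≡ true → isHead (step s coins) h ≡ true
      from e with ∧-true {isHead s h} e
      ... | hh , kh = ≡⇒== (trans (cong up (==⇒≡ hh)) (up-kept h kh))

    F-comp-step : ∀ h v → inF s h ≡ true → (head (step s coins) v == h) ≡ (head s v == h)
    F-comp-step h v hF = ≡true-ext to from
      where
      to : (head (step s coins) v == h) ≡ true → (head s v == h) ≡ true
      to e = ≡⇒== (climb-into-F n (head s v) h (head-idem v) hF (==⇒≡ e))
      from : (head s v == h) ≡ true → (head (step s coins) v == h) ≡ true
      from e = ≡⇒== (trans (cong up (==⇒≡ e)) (up-kept h (F⇒kept h hF)))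

    module Merged (a : Fin n) where
      mergedInto : Fin n → Bool
      mergedInto c = isHead s c ∧ (up c == a)

      nonRootHead : Fin n → Bool
      nonRootHead h = isHead s h ∧ not (isRoot h)

      childCount-step : childCount (step s coins) a ≡ count (λ h → (nonRootHead h ∧ mergedInto (parentComp s h)) ∧ kept h)
      childCount-step = trans (childCount≡count (step s coins) a) (count-cong {n} pointwise)
        where
        rearrange : ∀ x y r z → (x ∧ y) ∧ (r ∧ z) ≡ ((x ∧ r) ∧ (true ∧ z)) ∧ y
        rearrange true  true  r z = sym (∧-identityʳ _)
        rearrange true  false r z = sym (∧-zeroʳ _)
        rearrange false y     r z = refl
        pointwise : ∀ h → isHead (step s coins) h ∧ (not (isRoot h) ∧ (up (parentComp s h) == a))
                        ≡ (nonRootHead h ∧ mergedInto (parentComp s h)) ∧ kept h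
        pointwise h rewrite isHead-step h | ≡⇒== (head-idem (parent h)) =
          rearrange (isHead s h) (kept h) (not (isRoot h)) (up (parentComp s h) == a)

      merged-via-parent : ∀ h → kept h ≡ false → (nonRootHead h ∧ mergedInto (parentComp s h)) ≡ mergedInto h
      merged-via-parent h ¬kh
        rewrite Dropped.non-root (dropped h ¬kh) | ≡⇒== (head-idem (parent h)) | up-dropped h ¬kh =
        cong (_∧ (up (parentComp s h) == a)) (∧-identityʳ (isHead s h))

      dropped-children : count (λ h → (nonRootHead h ∧ mergedInto (parentComp s h)) ∧ not (kept h))
                         ≡ count (λ c → mergedInto c ∧ not (kept c))
      dropped-children = count-cong {n} pointwise
        where
        pointwise : ∀ h → ((nonRootHead h ∧ mergedInto (parentComp s h)) ∧ not (kept h)) ≡ (mergedInto h ∧ not (kept h))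
        pointwise h with kept h in kh
        ... | true  = trans (∧-zeroʳ _) (sym (∧-zeroʳ _))
        ... | false = cong (_∧ true) (merged-via-parent h kh)

      childCount-merged-≤ : ∀ c → ⟦ mergedInto c ⟧ * childCount s c ≤ ⟦ a == c ⟧ * 2 + ⟦ mergedInto c ∧ not (kept c) ⟧
      childCount-merged-≤ c with mergedInto c in eM
      ... | false = z≤n
      ... | true with ∧-true {isHead s c} eM | kept c in eK
      ...   | hc , uc | true  = subst (λ b → childCount s c + 0 ≤ ⟦ b ⟧ * 2 + 0) (sym (≡⇒== (sym c≡a)))
                                      (+-monoˡ-≤ 0 (comps-binary c (==⇒≡ hc)))
        where c≡a = trans (sym (up-kept c eK)) (==⇒≡ uc)
      ...   | hc , uc | false = ≤-trans (+-monoˡ-≤ 0 (≤2∧≢2⇒≤1 (comps-binary c (==⇒≡ hc)) (Dropped.¬two (dropped c eK))))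
                                        (m≤n+m 1 _)

      ∑-childCount-≤ : ∑[ c < n ] (⟦ mergedInto c ⟧ * childCount s c) ≤ 2 + count (λ c → mergedInto c ∧ not (kept c))
      ∑-childCount-≤ = ≤-trans (∑-mono-≤ childCount-merged-≤)
        (≤-reflexive (trans (∑-distrib-+ {n} _ _) (cong (_+ count (λ c → mergedInto c ∧ not (kept c))) (∑-point a (const 2)))))

      childCount-step-≤2 : childCount (step s coins) a ≤ 2
      childCount-step-≤2 = +-cancelʳ-≤ Y _ _ (begin
        childCount (step s coins) a + Y ≡⟨ cong₂ _+_ childCount-step (sym dropped-children) ⟩
        count (λ h → (nonRootHead h ∧ mergedInto (parentComp s h)) ∧ kept h)
          + count (λ h → (nonRootHead h ∧ mergedInto (parentComp s h)) ∧ not (kept h))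
                                         ≡⟨ count-split (λ h → nonRootHead h ∧ mergedInto (parentComp s h)) kept ⟨
        count (λ h → nonRootHead h ∧ mergedInto (parentComp s h)) ≡⟨ ∑-weighted-childCount s mergedInto ⟨
        ∑[ c < n ] (⟦ mergedInto c ⟧ * childCount s c) ≤⟨ ∑-childCount-≤ ⟩
        2 + Y                           ∎)
        where
        open ≤-Reasoning
        Y = count (λ c → mergedInto c ∧ not (kept c))

    F-step : ∀ h → inF (step s coins) h ≡ true → (head (step s coins) h ≡ h) × (n ≤ compSize (head (step s coins)) h * m)
    F-step h e with inF s h in hF
    ... | true  = trans (cong up (F⇒head h hF)) (up-kept h (F⇒kept h hF))
                , subst (λ k → n ≤ k * m) (sym same-size) (F-large h hF)
      where
      same-size : compSize (head (step s coins)) h ≡ compSize (head s) h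
      same-size = trans (compSize≡count (head (step s coins)) h)
                        (trans (count-cong {n} (λ v → F-comp-step h v hF)) (sym (compSize≡count (head s) h)))
    ... | false with ∧-true {head (step s coins) h == h} e
    ...   | isH , large = ==⇒≡ isH , ≤ᵇ⇒≤ n _ (Equivalence.from T-≡ large)

    wellFormed-step : WellFormed (step s coins)
    wellFormed-step = record
      { head-idem    = λ v → trans (cong up (climb-isHead n (head s v) (head-idem v)))
                                   (up-kept _ (climb-isKept n (head s v) (toℕ<n _)))
      ; head-≤       = λ v → ≤-trans (climb-≤ n (head s v)) (head-≤ v)
      ; comps-binary = λ c _ → Merged.childCount-step-≤2 c
      ; F⇒head       = λ h e → proj₁ (F-step h e)
      ; F-large      = λ h e → proj₂ (F-step h e)
      }

-- Expected number of components after an iteration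

count-isRoot-≤1 : ∀ k → count {k} isRoot ≤ 1
count-isRoot-≤1 zero    = z≤n
count-isRoot-≤1 (suc k) = ≤-reflexive (cong suc (sum-replicate-zero k))

contraction-arith : ∀ {m N} → 1 ≤ m → 14 * m < N → 7 * (6 * m + 2 + N) ≤ 11 * N
contraction-arith {suc j} {N} _ 14m<N = begin
  7 * (6 * suc j + 2 + N)      ≡⟨ expand j N ⟩
  (42 * suc j + 14) + 7 * N
    ≤⟨ +-monoˡ-≤ (7 * N) (≤-trans (m≤m+n (42 * suc j + 14) (14 * j + 4)) (≤-reflexive (quadruple j))) ⟩
  4 * suc (14 * suc j) + 7 * N ≤⟨ +-monoˡ-≤ (7 * N) (*-monoʳ-≤ 4 14m<N) ⟩
  4 * N + 7 * N                ≡⟨ *-distribʳ-+ N 4 7 ⟨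
  11 * N                       ∎
  where
  open ≤-Reasoning
  expand : ∀ j N → 7 * (6 * suc j + 2 + N) ≡ (42 * suc j + 14) + 7 * N
  expand = solve-∀
  quadruple : ∀ j → 42 * suc j + 14 + (14 * j + 4) ≡ 4 * suc (14 * suc j)
  quadruple = solve-∀

module Expectation {n : ℕ} (Tb : BinaryTree n) (m : ℕ) where
  open BinaryTree Tb
  open DECOMP Tb m
  open State
  open Invariant Tb m

  -- `not (isRoot h)` guards against the junk value of `parentComp` at the root.
  forced : State n → Fin n → Bool
  forced s h = inF s h ∨ (isRoot h ∨ ((childCount s h ≡ᵇ 2) ∨ (not (isRoot h) ∧ inF s (parentComp s h))))

  oneChild : State n → Fin n → Bool
  oneChild s h = childCount s h ≡ᵇ 1

  module _ (s : State n) (wf : WellFormed s) where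
    open WellFormed wf

    numComps-step-≤ : ∀ coins → numComps (step s coins) ≤ count (λ h → isHead s h ∧ (forced s h ∨ (oneChild s h ∧ lookup coins h)))
    numComps-step-≤ coins = begin
      numComps (step s coins)                 ≡⟨ numComps≡count (step s coins) ⟩
      count (isHead (step s coins))           ≡⟨ count-cong {n} (Step.isHead-step s wf coins) ⟩
      count (λ h → isHead s h ∧ Step.kept s wf coins h)
        ≤⟨ count-mono (λ h e → let hh , kh = ∧-true {isHead s h} e in
                                ∧-intro hh (keptBy≡true (inF s h) (isRoot h) (childCount s h ≡ᵇ 2) (inF s (parentComp s h))
                                                        (oneChild s h) (lookup coins h) kh)) ⟩
      count (λ h → isHead s h ∧ (forced s h ∨ (oneChild s h ∧ lookup coins h))) ∎
      where open ≤-Reasoning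

    expected-numComps-step : 2 * (∑[ coins ∈ coinFlips n ] numComps (step s coins))
                             ≤ 2 ^ n * (2 * count (λ h → isHead s h ∧ forced s h) + count (λ h → isHead s h ∧ oneChild s h))
    expected-numComps-step = begin
      2 * sumOver W (λ cs → numComps (step s cs))
        ≤⟨ *-monoʳ-≤ 2 (sumOver-mono-≤ W numComps-step-≤) ⟩
      2 * sumOver W (λ cs → ∑[ h < n ] ⟦ survives cs h ⟧)
        ≡⟨ cong (2 *_) (sumOver-∑-comm W (λ cs h → ⟦ survives cs h ⟧)) ⟩
      2 * ∑[ h < n ] sumOver W (λ cs → ⟦ survives cs h ⟧)
        ≡⟨ *-distribˡ-sum {n} 2 _ ⟩
      ∑[ h < n ] (2 * sumOver W (λ cs → ⟦ survives cs h ⟧))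
        ≤⟨ ∑-mono-≤ survival-≤ ⟩
      ∑[ h < n ] (2 ^ n * (2 * ⟦ isHead s h ∧ forced s h ⟧ + ⟦ isHead s h ∧ oneChild s h ⟧))
        ≡⟨ *-distribˡ-sum {n} (2 ^ n) _ ⟨
      2 ^ n * ∑[ h < n ] (2 * ⟦ isHead s h ∧ forced s h ⟧ + ⟦ isHead s h ∧ oneChild s h ⟧)
        ≡⟨ cong (2 ^ n *_) (trans (∑-distrib-+ {n} _ _) (cong (_+ count (λ h → isHead s h ∧ oneChild s h)) (sym (*-distribˡ-sum {n} 2 _)))) ⟩
      2 ^ n * (2 * count (λ h → isHead s h ∧ forced s h) + count (λ h → isHead s h ∧ oneChild s h)) ∎
      where
      open ≤-Reasoning
      W = coinFlips n
      survives : Vec Bool n → Fin n → Bool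
      survives cs h = isHead s h ∧ (forced s h ∨ (oneChild s h ∧ lookup cs h))
      |W| : sumOver W (const 1) ≡ 2 ^ n
      |W| = trans (sym (length≡sumOver W)) (length-coinFlips n)
      nothing-survives : 2 * sumOver W (const 0) ≤ 2 ^ n * 0
      nothing-survives = ≤-reflexive (trans (cong (2 *_) (sumOver-zero W)) (sym (*-zeroʳ (2 ^ n))))
      survival-≤ : ∀ h → 2 * sumOver W (λ cs → ⟦ survives cs h ⟧)
                         ≤ 2 ^ n * (2 * ⟦ isHead s h ∧ forced s h ⟧ + ⟦ isHead s h ∧ oneChild s h ⟧)
      survival-≤ h with isHead s h | forced s h | oneChild s h
      ... | false | _     | _     = nothing-survives
      ... | true  | true  | one   = begin
        2 * sumOver W (const 1) ≡⟨ cong (2 *_) |W| ⟩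
        2 * 2 ^ n               ≡⟨ *-comm 2 (2 ^ n) ⟩
        2 ^ n * 2               ≤⟨ *-monoʳ-≤ (2 ^ n) (m≤m+n 2 ⟦ one ⟧) ⟩
        2 ^ n * (2 + ⟦ one ⟧)   ∎
      ... | true  | false | true  = ≤-reflexive (trans (fair-coin n h) (sym (*-identityʳ (2 ^ n))))
      ... | true  | false | false = nothing-survives

    -- The components of F are disjoint and each has at least n/m vertices.
    count-F-≤ : .{{NonZero n}} → count (inF s) ≤ m
    count-F-≤ = *-cancelˡ-≤ n (begin
      n * count (inF s)                  ≡⟨ *-distribˡ-sum {n} n _ ⟩
      ∑[ h < n ] (n * ⟦ inF s h ⟧)       ≤⟨ ∑-mono-≤ large ⟩
      ∑[ h < n ] (m * compSize (head s) h) ≡⟨ *-distribˡ-sum {n} m _ ⟨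
      m * ∑[ h < n ] compSize (head s) h ≡⟨ cong (m *_) (∑-compSize (head s)) ⟩
      m * n                              ≡⟨ *-comm m n ⟩
      n * m                              ∎)
      where
      open ≤-Reasoning
      large : ∀ h → n * ⟦ inF s h ⟧ ≤ m * compSize (head s) h
      large h with inF s h in e
      ... | true  = ≤-trans (≤-reflexive (*-identityʳ n)) (≤-trans (F-large h e) (≤-reflexive (*-comm _ m)))
      ... | false = ≤-trans (≤-reflexive (*-zeroʳ n)) z≤n

    count-childOfF-≤ : count (λ h → isHead s h ∧ (not (isRoot h) ∧ inF s (parentComp s h))) ≤ 2 * count (inF s)
    count-childOfF-≤ = begin
      count (λ h → isHead s h ∧ (not (isRoot h) ∧ inF s (parentComp s h)))
        ≡⟨ count-cong {n} (λ h → sym (∧-assoc (isHead s h) (not (isRoot h)) (inF s (parentComp s h)))) ⟩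
      count (λ h → (isHead s h ∧ not (isRoot h)) ∧ inF s (parentComp s h)) ≡⟨ ∑-weighted-childCount s (inF s) ⟨
      ∑[ c < n ] (⟦ inF s c ⟧ * childCount s c) ≤⟨ ∑-mono-≤ binary-F ⟩
      ∑[ c < n ] (2 * ⟦ inF s c ⟧)              ≡⟨ *-distribˡ-sum {n} 2 _ ⟨
      2 * count (inF s)                         ∎
      where
      open ≤-Reasoning
      binary-F : ∀ c → ⟦ inF s c ⟧ * childCount s c ≤ 2 * ⟦ inF s c ⟧
      binary-F c with inF s c in e
      ... | true  = +-monoˡ-≤ 0 (comps-binary c (F⇒head c e))
      ... | false = z≤n

    -- Every component other than the root is a child of exactly one component.
    count-branching-≤ : 2 * count (λ h → isHead s h ∧ (childCount s h ≡ᵇ 2)) + count (λ h → isHead s h ∧ oneChild s h) ≤ numComps s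
    count-branching-≤ = begin
      2 * count (λ h → isHead s h ∧ (childCount s h ≡ᵇ 2)) + count (λ h → isHead s h ∧ oneChild s h)
        ≡⟨ cong (_+ count (λ h → isHead s h ∧ oneChild s h)) (*-distribˡ-sum {n} 2 _) ⟩
      ∑[ h < n ] (2 * ⟦ isHead s h ∧ (childCount s h ≡ᵇ 2) ⟧) + count (λ h → isHead s h ∧ oneChild s h)
        ≡⟨ ∑-distrib-+ {n} _ _ ⟨
      ∑[ h < n ] (2 * ⟦ isHead s h ∧ (childCount s h ≡ᵇ 2) ⟧ + ⟦ isHead s h ∧ oneChild s h ⟧)
        ≤⟨ ∑-mono-≤ (λ c → branching (isHead s c) (childCount s c)) ⟩
      ∑[ c < n ] (⟦ isHead s c ⟧ * childCount s c)
        ≡⟨ ∑-weighted-childCount s (isHead s) ⟩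
      count (λ h → (isHead s h ∧ not (isRoot h)) ∧ isHead s (parentComp s h))
        ≤⟨ count-mono (λ h e → proj₁ (∧-true {isHead s h} (proj₁ (∧-true {isHead s h ∧ not (isRoot h)} e)))) ⟩
      count (isHead s)
        ≡⟨ numComps≡count s ⟨
      numComps s ∎
      where
      open ≤-Reasoning
      branching : ∀ b x → 2 * ⟦ b ∧ (x ≡ᵇ 2) ⟧ + ⟦ b ∧ (x ≡ᵇ 1) ⟧ ≤ ⟦ b ⟧ * x
      branching false x                   = z≤n
      branching true  zero                = z≤n
      branching true  (suc zero)          = s≤s z≤n
      branching true  (suc (suc zero))    = s≤s (s≤s z≤n)
      branching true  (suc (suc (suc x))) = z≤n

    count-forced-oneChild-≤ : .{{NonZero n}} →
      2 * count (λ h → isHead s h ∧ forced s h) + count (λ h → isHead s h ∧ oneChild s h) ≤ 6 * m + 2 + numComps s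
    count-forced-oneChild-≤ = begin
      2 * count (λ h → isHead s h ∧ forced s h) + one ≤⟨ +-monoˡ-≤ one (*-monoʳ-≤ 2 forced-≤) ⟩
      2 * (f + r + two + cF) + one
        ≤⟨ +-monoˡ-≤ one (*-monoʳ-≤ 2 (+-mono-≤ (+-monoˡ-≤ two (+-mono-≤ count-F-≤ (count-isRoot-≤1 n))) cF≤)) ⟩
      2 * (m + 1 + two + 2 * m) + one                 ≡⟨ regroup m two one ⟩
      6 * m + 2 + (2 * two + one)                     ≤⟨ +-monoʳ-≤ (6 * m + 2) count-branching-≤ ⟩
      6 * m + 2 + numComps s                          ∎
      where
      open ≤-Reasoning
      f   = count (inF s)
      r   = count {n} isRoot
      two = count (λ h → isHead s h ∧ (childCount s h ≡ᵇ 2))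
      cF  = count (λ h → isHead s h ∧ (not (isRoot h) ∧ inF s (parentComp s h)))
      one = count (λ h → isHead s h ∧ oneChild s h)
      cF≤ : cF ≤ 2 * m
      cF≤ = ≤-trans count-childOfF-≤ (*-monoʳ-≤ 2 count-F-≤)
      union-bound : ∀ h f r t x → ⟦ h ∧ (f ∨ (r ∨ (t ∨ x))) ⟧ ≤ ⟦ f ⟧ + ⟦ r ⟧ + ⟦ h ∧ t ⟧ + ⟦ h ∧ x ⟧
      union-bound false f     r     t     x     = z≤n
      union-bound true  true  r     t     x     = s≤s z≤n
      union-bound true  false true  t     x     = s≤s z≤n
      union-bound true  false false true  x     = s≤s z≤n
      union-bound true  false false false true  = s≤s z≤n
      union-bound true  false false false false = z≤n
      forced-≤ : count (λ h → isHead s h ∧ forced s h) ≤ f + r + two + cF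
      forced-≤ = ≤-trans
        (∑-mono-≤ (λ h → union-bound (isHead s h) (inF s h) (isRoot h) (childCount s h ≡ᵇ 2) (not (isRoot h) ∧ inF s (parentComp s h))))
        (≤-reflexive (trans (∑-distrib-+ {n} _ _) (cong (_+ cF) (trans (∑-distrib-+ {n} _ _) (cong (_+ two) (∑-distrib-+ {n} _ _))))))
      regroup : ∀ m t e → 2 * (m + 1 + t + 2 * m) + e ≡ 6 * m + 2 + (2 * t + e)
      regroup = solve-∀

  potential : State n → ℕ
  potential s = if loopCond s then numComps s else 0

  potential-≤ : ∀ s → potential s ≤ numComps s
  potential-≤ s with loopCond s
  ... | true  = ≤-refl
  ... | false = z≤n

  loopCond-≤-potential : ∀ s → ⟦ loopCond s ⟧ ≤ potential s
  loopCond-≤-potential s with loopCond s in e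
  ... | true  = ≤-trans (s≤s z≤n) (<ᵇ⇒< (14 * m) (numComps s) (Equivalence.from T-≡ e))
  ... | false = z≤n

  module _ (s : State n) where

    guardedStep-running : ∀ coins → loopCond s ≡ true → guardedStep s coins ≡ step s coins
    guardedStep-running coins e rewrite e = refl

    guardedStep-stopped : ∀ coins → loopCond s ≡ false → guardedStep s coins ≡ s
    guardedStep-stopped coins e rewrite e = refl

    potential-running : loopCond s ≡ true → potential s ≡ numComps s
    potential-running e rewrite e = refl

    wellFormed-guardedStep : WellFormed s → ∀ coins → WellFormed (guardedStep s coins)
    wellFormed-guardedStep wf coins = by-loopCond (loopCond s) refl
      where
      by-loopCond : ∀ b → loopCond s ≡ b → WellFormed (guardedStep s coins)
      by-loopCond true  e = subst WellFormed (sym (guardedStep-running coins e)) (Step.wellFormed-step s wf coins)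
      by-loopCond false e = subst WellFormed (sym (guardedStep-stopped coins e)) wf

    potential-stopped : loopCond s ≡ false → potential s ≡ 0
    potential-stopped e rewrite e = refl

    contraction : WellFormed s → 1 ≤ m →
                  14 * (∑[ coins ∈ coinFlips n ] potential (guardedStep s coins)) ≤ 11 * 2 ^ n * potential s
    contraction wf 1≤m = by-loopCond (loopCond s) refl
      where
      W = coinFlips n
      N = numComps s
      by-loopCond : ∀ b → loopCond s ≡ b → 14 * sumOver W (λ cs → potential (guardedStep s cs)) ≤ 11 * 2 ^ n * potential s
      by-loopCond false e = ≤-trans (≤-reflexive (trans (cong (14 *_) (trans stays (sumOver-zero W))) (*-zeroʳ 14))) z≤n
        where
        stays : sumOver W (λ cs → potential (guardedStep s cs)) ≡ sumOver W (const 0)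
        stays = sumOver-cong W (λ cs → trans (cong potential (guardedStep-stopped cs e)) (potential-stopped e))
      by-loopCond true e = begin
        14 * sumOver W (λ cs → potential (guardedStep s cs))
          ≡⟨ cong (14 *_) (sumOver-cong W (λ cs → cong potential (guardedStep-running cs e))) ⟩
        14 * sumOver W (λ cs → potential (step s cs))
          ≤⟨ *-monoʳ-≤ 14 (sumOver-mono-≤ W (λ cs → potential-≤ (step s cs))) ⟩
        14 * sumOver W (λ cs → numComps (step s cs))
          ≡⟨ *-assoc 7 2 (sumOver W (λ cs → numComps (step s cs))) ⟩
        7 * (2 * sumOver W (λ cs → numComps (step s cs)))   ≤⟨ *-monoʳ-≤ 7 (expected-numComps-step s wf) ⟩
        7 * (2 ^ n * (2 * count (λ h → isHead s h ∧ forced s h) + count (λ h → isHead s h ∧ oneChild s h)))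
                                                            ≤⟨ *-monoʳ-≤ 7 (*-monoʳ-≤ (2 ^ n) (count-forced-oneChild-≤ s wf {{>-nonZero 0<n}})) ⟩
        7 * (2 ^ n * (6 * m + 2 + N))                       ≡⟨ x∙yz≈y∙xz 7 (2 ^ n) _ ⟩
        2 ^ n * (7 * (6 * m + 2 + N))                       ≤⟨ *-monoʳ-≤ (2 ^ n) (contraction-arith 1≤m 14m<N) ⟩
        2 ^ n * (11 * N)                                    ≡⟨ x∙yz≈y∙xz (2 ^ n) 11 N ⟩
        11 * (2 ^ n * N)                                    ≡⟨ *-assoc 11 (2 ^ n) N ⟨
        11 * 2 ^ n * N                                      ≡⟨ cong (11 * 2 ^ n *_) (potential-running e) ⟨
        11 * 2 ^ n * potential s                            ∎
        where
        open ≤-Reasoning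
        14m<N : 14 * m < N
        14m<N = <ᵇ⇒< (14 * m) N (Equivalence.from T-≡ e)
        0<n : 0 < n
        0<n = ≤-trans (≤-trans (s≤s z≤n) 14m<N) (≤-trans (≤-reflexive (numComps≡count s)) (count≤n (isHead s)))

  iterated-contraction : 1 ≤ m → ∀ L s → WellFormed s →
    14 ^ L * (∑[ coins ∈ vecsOf (coinFlips n) L ] potential (runFrom s coins)) ≤ 11 ^ L * (2 ^ n) ^ L * potential s
  iterated-contraction 1≤m zero    s wf = ≤-reflexive (+-identityʳ _)
  iterated-contraction 1≤m (suc L) s wf = begin
    14 ^ suc L * sumOver (vecsOf W (suc L)) (λ cs → potential (runFrom s cs))
      ≡⟨ cong (14 ^ suc L *_) (sumOver-vecsOf-suc W L _) ⟩
    14 * 14 ^ L * sumOver W (λ c → sumOver (vecsOf W L) (λ cs → potential (runFrom (guardedStep s c) cs)))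
      ≡⟨ trans (*-assoc 14 (14 ^ L) _) (cong (14 *_) (*-distribˡ-sumOver (14 ^ L) W _)) ⟩
    14 * sumOver W (λ c → 14 ^ L * sumOver (vecsOf W L) (λ cs → potential (runFrom (guardedStep s c) cs)))
      ≤⟨ *-monoʳ-≤ 14 (sumOver-mono-≤ W (λ c → iterated-contraction 1≤m L (guardedStep s c) (wellFormed-guardedStep s wf c))) ⟩
    14 * sumOver W (λ c → q * potential (guardedStep s c))
      ≡⟨ cong (14 *_) (*-distribˡ-sumOver q W _) ⟨
    14 * (q * sumOver W (λ c → potential (guardedStep s c)))
      ≡⟨ x∙yz≈y∙xz 14 q _ ⟩
    q * (14 * sumOver W (λ c → potential (guardedStep s c)))
      ≤⟨ *-monoʳ-≤ q (contraction s wf 1≤m) ⟩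
    q * (11 * 2 ^ n * potential s)
      ≡⟨ regroup (11 ^ L) ((2 ^ n) ^ L) (2 ^ n) (potential s) ⟩
    11 ^ suc L * (2 ^ n) ^ suc L * potential s ∎
    where
    open ≤-Reasoning
    W = coinFlips n
    q = 11 ^ L * (2 ^ n) ^ L
    regroup : ∀ a b c d → a * b * (11 * c * d) ≡ (11 * a) * (c * b) * d
    regroup = solve-∀

  badCount≤∑potential : ∀ L → badCount Tb m L ≤ ∑[ coins ∈ coinOutcomes n L ] potential (runFrom initial coins)
  badCount≤∑potential L = ≤-trans (≤-reflexive (length-filter (moreThan L) (coinOutcomes n L)))
                         (sumOver-mono-≤ (coinOutcomes n L) (λ cs → loopCond-≤-potential (runFrom initial cs)))

  badCount-bound : 1 ≤ m → ∀ L → 14 ^ L * badCount Tb m L ≤ 11 ^ L * (2 ^ n) ^ L * n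
  badCount-bound 1≤m L = begin
    14 ^ L * badCount Tb m L                                          ≤⟨ *-monoʳ-≤ (14 ^ L) (badCount≤∑potential L) ⟩
    14 ^ L * sumOver (coinOutcomes n L) (λ cs → potential (runFrom initial cs))
      ≤⟨ iterated-contraction 1≤m L initial wellFormed-initial ⟩
    11 ^ L * (2 ^ n) ^ L * potential initial
      ≤⟨ *-monoʳ-≤ (11 ^ L * (2 ^ n) ^ L) initial-≤ ⟩
    11 ^ L * (2 ^ n) ^ L * n                                          ∎
    where
    open ≤-Reasoning
    initial-≤ : potential initial ≤ n
    initial-≤ = ≤-trans (potential-≤ initial) (≤-trans (≤-reflexive (numComps≡count initial)) (count≤n (isHead initial)))

length-coinOutcomes : ∀ n L → length (coinOutcomes n L) ≡ (2 ^ n) ^ L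
length-coinOutcomes n L = trans (length-vecsOf (coinFlips n) L) (cong (_^ L) (length-coinFlips n))

-- Logarithms

^-distribʳ-* : ∀ a b k → (a * b) ^ k ≡ a ^ k * b ^ k
^-distribʳ-* a b zero    = refl
^-distribʳ-* a b (suc k) = trans (cong (a * b *_) (^-distribʳ-* a b k)) ([m*n]*[o*p]≡[m*o]*[n*p] a b (a ^ k) (b ^ k))

1≤⌊log₂n⌋ : ∀ {n} → 2 ≤ n → 1 ≤ ⌊log₂ n ⌋
1≤⌊log₂n⌋ 2≤n = ≤-trans (≤-reflexive (sym (⌊log₂[2^n]⌋≡n 1))) (⌊log₂⌋-mono-≤ 2≤n)

n≤1+2⌊n/2⌋ : ∀ n → n ≤ suc (⌊ n /2⌋ + ⌊ n /2⌋)
n≤1+2⌊n/2⌋ zero          = z≤n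
n≤1+2⌊n/2⌋ (suc zero)    = s≤s z≤n
n≤1+2⌊n/2⌋ (suc (suc n)) = s≤s (s≤s (≤-trans (n≤1+2⌊n/2⌋ n) (≤-reflexive (sym (+-suc ⌊ n /2⌋ ⌊ n /2⌋)))))

n<2^suc⌊log₂n⌋ : ∀ n → n < 2 ^ suc ⌊log₂ n ⌋
n<2^suc⌊log₂n⌋ = <-rec _ bound
  where
  bound : ∀ n → (∀ {k} → k < n → k < 2 ^ suc ⌊log₂ k ⌋) → n < 2 ^ suc ⌊log₂ n ⌋
  bound zero            _   = m^n>0 2 (suc ⌊log₂ 0 ⌋)
  bound (suc zero)      _   = *-monoʳ-≤ 2 (m^n>0 2 ⌊log₂ 1 ⌋)
  bound n@(suc (suc j)) rec = begin-strict
    n               ≤⟨ n≤1+2⌊n/2⌋ n ⟩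
    suc (h + h)     <⟨ s≤s (≤-reflexive (sym (+-suc h h))) ⟩
    suc h + suc h   ≤⟨ +-mono-≤ 1+h≤2^k 1+h≤2^k ⟩
    2 ^ k + 2 ^ k   ≡⟨ cong (2 ^ k +_) (+-identityʳ (2 ^ k)) ⟨
    2 ^ suc k       ∎
    where
    open ≤-Reasoning
    h = ⌊ n /2⌋
    k = ⌊log₂ n ⌋
    log₂h : suc ⌊log₂ h ⌋ ≡ k
    log₂h = trans (cong suc (⌊log₂⌊n/2⌋⌋≡⌊log₂n⌋∸1 n)) (m+[n∸m]≡n (1≤⌊log₂n⌋ {n} (s≤s (s≤s z≤n))))
    1+h≤2^k : suc h ≤ 2 ^ k
    1+h≤2^k = subst (λ e → suc h ≤ 2 ^ e) log₂h (rec (⌊n/2⌋<n (suc j)))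

n≤4^⌊log₂n⌋ : ∀ {n} → 2 ≤ n → n ≤ 4 ^ ⌊log₂ n ⌋
n≤4^⌊log₂n⌋ {n} 2≤n = begin
  n             ≤⟨ <⇒≤ (n<2^suc⌊log₂n⌋ n) ⟩
  2 * 2 ^ k     ≤⟨ *-monoˡ-≤ (2 ^ k) (^-monoʳ-≤ 2 (1≤⌊log₂n⌋ 2≤n)) ⟩
  2 ^ k * 2 ^ k ≡⟨ ^-distribʳ-* 2 2 k ⟨
  4 ^ k         ∎
  where
  open ≤-Reasoning
  k = ⌊log₂ n ⌋

n^suc[d]*11^L≤14^L : ∀ d {n} → 2 ≤ n → n ^ suc d * 11 ^ (6 * suc d * ⌊log₂ n ⌋) ≤ 14 ^ (6 * suc d * ⌊log₂ n ⌋)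
n^suc[d]*11^L≤14^L d {n} 2≤n = begin
  n ^ suc d * 11 ^ (6 * suc d * k)  ≡⟨ cong (λ e → n ^ suc d * 11 ^ e) (*-assoc 6 (suc d) k) ⟩
  n ^ suc d * 11 ^ (6 * x)          ≤⟨ *-monoˡ-≤ _ (^-monoˡ-≤ (suc d) (n≤4^⌊log₂n⌋ 2≤n)) ⟩
  (4 ^ k) ^ suc d * 11 ^ (6 * x)
    ≡⟨ cong₂ _*_ (trans (^-*-assoc 4 k (suc d)) (cong (4 ^_) (*-comm k (suc d)))) (sym (^-*-assoc 11 6 x)) ⟩
  4 ^ x * (11 ^ 6) ^ x              ≡⟨ ^-distribʳ-* 4 (11 ^ 6) x ⟨
  (4 * 11 ^ 6) ^ x                  ≤⟨ ^-monoˡ-≤ x (≤ᵇ⇒≤ (4 * 11 ^ 6) (14 ^ 6) _) ⟩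
  (14 ^ 6) ^ x                      ≡⟨ ^-*-assoc 14 6 x ⟩
  14 ^ (6 * x)                      ≡⟨ cong (14 ^_) (*-assoc 6 (suc d) k) ⟨
  14 ^ (6 * suc d * k)              ∎
  where
  open ≤-Reasoning
  k = ⌊log₂ n ⌋
  x = suc d * k

corollary2 : (d : ℕ) → ∃[ c ] ∃[ n₀ ] ((n : ℕ) → n₀ ≤ n → (Tb : BinaryTree n) → (m : ℕ) → 1 ≤ m →
               badCount Tb m (c * ⌊log₂ n ⌋) * n ^ d ≤ length (coinOutcomes n (c * ⌊log₂ n ⌋)))
corollary2 d = 6 * suc d , 2 , bound
  where
  bound : (n : ℕ) → 2 ≤ n → (Tb : BinaryTree n) → (m : ℕ) → 1 ≤ m →
          badCount Tb m (6 * suc d * ⌊log₂ n ⌋) * n ^ d ≤ length (coinOutcomes n (6 * suc d * ⌊log₂ n ⌋))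
  bound n 2≤n Tb m 1≤m = *-cancelˡ-≤ (14 ^ L) {{m^n≢0 14 L}} (begin
    14 ^ L * (B * n ^ d)              ≡⟨ *-assoc (14 ^ L) B (n ^ d) ⟨
    14 ^ L * B * n ^ d                ≤⟨ *-monoˡ-≤ (n ^ d) (Expectation.badCount-bound Tb m 1≤m L) ⟩
    11 ^ L * W * n * n ^ d            ≡⟨ regroup (11 ^ L) W n (n ^ d) ⟩
    W * (n ^ suc d * 11 ^ L)          ≤⟨ *-monoʳ-≤ W (n^suc[d]*11^L≤14^L d 2≤n) ⟩
    W * 14 ^ L                        ≡⟨ *-comm W (14 ^ L) ⟩
    14 ^ L * W                        ≡⟨ cong (14 ^ L *_) (length-coinOutcomes n L) ⟨
    14 ^ L * length (coinOutcomes n L) ∎)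
    where
    open ≤-Reasoning
    L = 6 * suc d * ⌊log₂ n ⌋
    B = badCount Tb m L
    W = (2 ^ n) ^ L
    regroup : ∀ q w n e → q * w * n * e ≡ w * (n * e * q)
    regroup = solve-∀
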